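{- Let $G_0=(V_0,E_0)$ be a semisimple graph, $\mathcal{M}$ a matroid on $E_0$ with rank function $r$, $G=(V,E)$ a subgraph of $G_0$, and $d\ge1$. Suppose that $\mathcal{M}$ has the $d$-dimensional $0$-extension property. (a) A subset $K\subseteq V$ is an $\mathcal{M}$-seed of $G$ if and only if there exist an $\mathcal{M}$-independent subgraph $I_K=(K,F)$ of $G[K]$ and an $\mathcal{M}$-basis $B_G$ of $G$ such that $B_G$ can be obtained from $I_K$ by a sequence of $d$-dimensional $0$-extensions. (b) If $K\subseteq V$ is an $\mathcal{M}$-seed of $G$ and $v\in V-K$ satisfies $|(K+v)\cap N_G(v)|\ge d$, then $K+v$ is also an $\mathcal{M}$-seed of $G$.
   Context: A semisimple graph has no parallel edges and at most one loop at each vertex. For a subgraph $H$ write $r(H)$ for the rank of its edge set. A subgraph $H$ of $G_0$ is $\mathcal{M}$-independent if $r(E(H))=|E(H)|$; a subgraph $G'$ of $G$ is an $\mathcal{M}$-basis of $G$ if it is $\mathcal{M}$-independent and $r(E(G'))=r(E)$. $N_G(x)$ denotes the set of vertices adjacent to $x$ in $G$ (including $x$ itself if $G$ has a loop at $x$). A $d$-dimensional $0$-extension of a graph $H$ adds a new vertex $v$ and joins $v$ to $d$ distinct vertices of $V(H)+v$ (where joining $v$ to itself means adding the loop $vv$). $\mathcal{M}$ has the $d$-dimensional $0$-extension property if whenever $G_1,G_2$ are subgraphs of $G_0$, $G_1$ is $\mathcal{M}$-independent and $G_2$ is a $d$-dimensional $0$-extension of $G_1$, then $G_2$ is $\mathcal{M}$-independent.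 A subset $K\subseteq V$ is an $\mathcal{M}$-seed of $G$ (with respect to $d$) if (i) $r(G)=r(G[K])+d|V-K|$, and (ii) for every $K'$ with $K\subseteq K'\subsetneq V$ there is a vertex $x\in V-K'$ with $|(K'+x)\cap N_G(x)|\ge d$. -}

module Defs where

open import Data.Nat using (ℕ; _+_; _*_; _≤_)
open import Data.Fin using (Fin; _≟_)
open import Data.Fin.Properties using (any?)
open import Data.Fin.Subset using (Subset; _∈_; _∉_; _⊆_; _∪_; _∩_; _─_; ⁅_⁆; ∣_∣)
open import Data.Fin.Subset.Properties using (_∈?_)
open import Data.Vec using (tabulate)
open import Data.Product using (Σ; _×_; _,_; proj₁; proj₂; ∃)
open import Data.Product.Properties using (≡-dec)
open import Data.Sum using (_⊎_)
open import Relation.Nullary using (Dec; does; ¬_)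
open import Relation.Nullary.Decidable using (_×-dec_; _⊎-dec_)
open import Relation.Binary.PropositionalEquality using (_≡_; _≢_)
open import Relation.Binary.Construct.Closure.ReflexiveTransitive using (Star)

-- The ground graph G₀ = (V₀, E₀):
--   V₀ = Fin n, E₀ = Fin m, and  ends : Fin m → Fin n × Fin n  gives the
--   (unordered) pair of end vertices of each edge; a loop at x has ends (x , x).

Joins : ∀ {n m} → (Fin m → Fin n × Fin n) → Fin m → Fin n → Fin n → Set
Joins ends e x y = (ends e ≡ (x , y)) ⊎ (ends e ≡ (y , x))

joins? : ∀ {n m} (ends : Fin m → Fin n × Fin n) e x y → Dec (Joins ends e x y)
joins? ends e x y = ≡-dec _≟_ _≟_ (ends e) (x , y) ⊎-dec ≡-dec _≟_ _≟_ (ends e) (y , x)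

Incident : ∀ {n m} → (Fin m → Fin n × Fin n) → Fin m → Fin n → Set
Incident ends e v = (proj₁ (ends e) ≡ v) ⊎ (proj₂ (ends e) ≡ v)

-- G₀ is semisimple: no two distinct edges have the same (unordered) pair of
-- ends.  (Hence no parallel edges and at most one loop at each vertex.)
Semisimple : ∀ {n m} → (Fin m → Fin n × Fin n) → Set
Semisimple ends = ∀ e f → Joins ends f (proj₁ (ends e)) (proj₂ (ends e)) → e ≡ f

record Matroid (m : ℕ) : Set where
  field
    r       : Subset m → ℕ
    r-bound : ∀ X → r X ≤ ∣ X ∣
    r-mono  : ∀ {X Y} → X ⊆ Y → r X ≤ r Y
    r-submod : ∀ X Y → r (X ∪ Y) + r (X ∩ Y) ≤ r X + r Y

-- (Candidate) subgraphs of G₀: a vertex set and an edge set.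

record Graph (n m : ℕ) : Set where
  constructor graph
  field
    V : Subset n
    E : Subset m
open Graph public

module _ {n m : ℕ} (ends : Fin m → Fin n × Fin n) where

  WF : Graph n m → Set
  WF H = ∀ e → e ∈ E H → (proj₁ (ends e) ∈ V H) × (proj₂ (ends e) ∈ V H)

  _≼_ : Graph n m → Graph n m → Set
  H ≼ G = WF H × (V H ⊆ V G) × (E H ⊆ E G)

  induced : Graph n m → Subset n → Graph n m
  induced G K = graph K (tabulate λ e →
    does ((e ∈? E G) ×-dec ((proj₁ (ends e) ∈? K) ×-dec (proj₂ (ends e) ∈? K))))

  -- N_G(x): vertices y joined to x by an edge of G (x itself iff loop at x)
  N : Graph n m → Fin n → Subset n
  N G x = tabulate λ y → does (any? λ e → (e ∈? E G) ×-dec joins? ends e x y)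

  -- d-dimensional 0-extension: H₂ is obtained from H₁ by adding a new
  -- vertex v and d edges incident with v (their other ends are distinct,
  -- since G₀ is semisimple, and lie in V(H₁)+v since H₂ is a subgraph).
  ZeroExt : ℕ → Graph n m → Graph n m → Set
  ZeroExt d H₁ H₂ =
    WF H₁ × WF H₂ ×
    Σ (Fin n) λ v →
      (v ∉ V H₁) ×
      (V H₂ ≡ V H₁ ∪ ⁅ v ⁆) ×
      (E H₁ ⊆ E H₂) ×
      (∀ e → e ∈ E H₂ → e ∉ E H₁ → Incident ends e v) ×
      (∣ E H₂ ∣ ≡ ∣ E H₁ ∣ + d)

  ZeroExts : ℕ → Graph n m → Graph n m → Set
  ZeroExts d = Star (ZeroExt d)

  module _ (M : Matroid m) where
    open Matroid M

    Independent : Graph n m → Set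
    Independent H = r (E H) ≡ ∣ E H ∣

    IsBasis : Graph n m → Graph n m → Set
    IsBasis G' G = (G' ≼ G) × Independent G' × (r (E G') ≡ r (E G))

    ZeroExtProperty : ℕ → Set
    ZeroExtProperty d = ∀ G₁ G₂ → WF G₁ → WF G₂ →
      Independent G₁ → ZeroExt d G₁ G₂ → Independent G₂

    Seed : ℕ → Graph n m → Subset n → Set
    Seed d G K =
      (r (E G) ≡ r (E (induced G K)) + d * ∣ V G ─ K ∣) ×
      (∀ K' → K ⊆ K' → K' ⊆ V G → K' ≢ V G →
         Σ (Fin n) λ x → (x ∈ V G) × (x ∉ K') ×
           (d ≤ ∣ (K' ∪ ⁅ x ⁆) ∩ N G x ∣))

-- Write r(K) for the rank of the edge set of G[K] and c(K) = |V(G) - K|.  Starting from a basis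
-- F of G[K], condition (ii) of a seed says exactly that (K, F) can be grown, one vertex at a
-- time, by d-dimensional 0-extensions inside G until all of V(G) is covered; by the
-- 0-extension property the final graph B is independent, so r(G) ≥ |E(B)| = r(K) + d c(K).
-- Hence (i) holds iff this B is a basis of G.  Conversely, any chain of 0-extensions from an
-- independent (K, F) to a basis B of G certifies (ii): for K ⊆ K' ⊊ V(G), the first vertex v
-- that the chain adds outside K' has its d new edges going to distinct vertices of K' + v
-- (G₀ is semisimple); and r(G) = |E(B)| = |F| + d c(K) ≤ r(K) + d c(K) is the missing half
-- of (i).  For (b), one 0-extension of a basis of G[K] at v gives r(K + v) ≥ r(K) + d, while
-- c(K) = c(K + v) + 1.

module Submission where

open import Defs
open import Data.Nat using (ℕ; zero; suc; _+_; _*_; _≤_; z≤n; s≤s; _≤?_)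
open import Data.Nat.Properties
  using (≤-trans; ≤-antisym; ≤-reflexive; ≰⇒>; +-assoc; +-comm;
         +-identityʳ; +-suc; m≤m+n; +-mono-≤; *-zeroʳ; *-suc; +-monoˡ-≤; +-monoʳ-≤; +-cancelʳ-≡; +-cancelʳ-≤;
         n≤0⇒n≡0; module ≤-Reasoning)
open import Data.Bool.Properties using () renaming (_≟_ to _≟ᵇ_)
open import Data.Fin using (Fin; zero; suc; _≟_)
open import Data.Fin.Properties using (any?; suc-injective)
open import Data.Fin.Subset
  using (Subset; inside; outside; _∈_; _∉_; _⊆_; _⊂_; _⊃_; _∪_; _∩_; _─_; _-_; ⁅_⁆; ∣_∣; ⊥; Empty)
open import Data.Fin.Subset.Properties
  using (_∈?_; nonempty?; Empty-unique; ∣⊥∣≡0; ∣⁅x⁆∣≡1; x∈⁅x⁆; x∈⁅y⁆⇒x≡y; ⊆-refl; ⊆-trans;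
         ⊆-antisym; ⊥⊆; p⊆q⇒∣p∣≤∣q∣; p∩q⊆q; x∈p∩q⁺; x∈p∩q⁻; p⊆p∪q; q⊆p∪q;
         x∈p∪q⁻; p─⊥≡p; p─q─r≡p─q∪r; x∈p∧x∉q⇒x∈p─q; p─q⊆p; x∈p∧x≢y⇒x∈p-y; x∈p⇒p-x⊂p;
         in⊆in; out⊆)
open import Data.Fin.Subset.Induction using (Acc; acc; ⊂-wellFounded; ⊃-wellFounded)
open import Data.Vec using ([]; _∷_; tabulate)
open import Data.Vec.Base using (here; there)
open import Data.Vec.Properties using ([]=⇒lookup; lookup⇒[]=; lookup∘tabulate; ≡-dec)
open import Data.Product using (Σ; ∃; _×_; _,_; proj₁; proj₂)
open import Data.Product.Properties using (,-injectiveˡ; ,-injectiveʳ; ,-injective)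
open import Data.Sum using (_⊎_; inj₁; inj₂)
open import Data.Empty using (⊥-elim)
open import Function using (_∘_; case_of_)
open import Function.Bundles using (_⇔_; mk⇔)
open import Relation.Nullary using (Dec; yes; no; does)
open import Relation.Nullary.Decidable using (dec-true; _×-dec_; _⊎-dec_)
open import Relation.Binary.PropositionalEquality
open import Relation.Binary.Construct.Closure.ReflexiveTransitive using (ε; _◅_)

private
  variable
    k : ℕ
    p q s t : Subset k
    x : Fin k

m+n+n*o≡m+n*[1+o] : ∀ m n o → m + n + n * o ≡ m + n * suc o
m+n+n*o≡m+n*[1+o] m n o = trans (+-assoc m n (n * o)) (cong (m +_) (sym (*-suc n o)))

∈-tabulate⁻ : ∀ {P : Fin k → Set} (P? : ∀ i → Dec (P i)) {i} →
  i ∈ tabulate (does ∘ P?) → P i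
∈-tabulate⁻ P? {i} i∈
  with P? i | trans (sym (lookup∘tabulate (does ∘ P?) i)) ([]=⇒lookup i∈)
... | yes Pi | _ = Pi
... | no _   | ()

∈-tabulate⁺ : ∀ {P : Fin k → Set} (P? : ∀ i → Dec (P i)) {i} →
  P i → i ∈ tabulate (does ∘ P?)
∈-tabulate⁺ P? {i} Pi =
  lookup⇒[]= i _ (trans (lookup∘tabulate (does ∘ P?) i) (dec-true (P? i) Pi))

∪-⊆ : p ⊆ s → q ⊆ s → p ∪ q ⊆ s
∪-⊆ {p = p} {q = q} p⊆s q⊆s x∈ with x∈p∪q⁻ p q x∈
... | inj₁ x∈p = p⊆s x∈p
... | inj₂ x∈q = q⊆s x∈q

∩-mono : p ⊆ s → q ⊆ t → p ∩ q ⊆ s ∩ t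
∩-mono {p = p} {q = q} p⊆s q⊆t x∈ =
  x∈p∩q⁺ (p⊆s (proj₁ (x∈p∩q⁻ p q x∈)) , q⊆t (proj₂ (x∈p∩q⁻ p q x∈)))

∈⇒⁅⁆⊆ : x ∈ p → ⁅ x ⁆ ⊆ p
∈⇒⁅⁆⊆ {x = x} {p = p} x∈p y∈ = subst (_∈ p) (sym (x∈⁅y⁆⇒x≡y x y∈)) x∈p

x∈p─q⇒x∉q : x ∈ p ─ q → x ∉ q
x∈p─q⇒x∉q {p = _ ∷ _} {q = inside ∷ _} () here
x∈p─q⇒x∉q {p = _ ∷ _} {q = _ ∷ _} (there x∈p─q) (there x∈q) = x∈p─q⇒x∉q x∈p─q x∈q

∣p─p∣≡0 : ∀ (p : Subset k) → ∣ p ─ p ∣ ≡ 0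
∣p─p∣≡0 {k} p = trans (cong ∣_∣ p─p≡⊥) (∣⊥∣≡0 k)
  where
  p─p≡⊥ : p ─ p ≡ ⊥
  p─p≡⊥ = Empty-unique λ (_ , x∈) → x∈p─q⇒x∉q x∈ (p─q⊆p p p x∈)

∣p∣≡1+∣p-x∣ : x ∈ p → ∣ p ∣ ≡ suc ∣ p - x ∣
∣p∣≡1+∣p-x∣ {p = inside ∷ p} here = cong (suc ∘ ∣_∣) (sym (p─⊥≡p p))
∣p∣≡1+∣p-x∣ {p = inside ∷ p} (there x∈p) = cong suc (∣p∣≡1+∣p-x∣ x∈p)
∣p∣≡1+∣p-x∣ {p = outside ∷ p} (there x∈p) = ∣p∣≡1+∣p-x∣ x∈p

∣p∣≡∣p─q∣+∣p∩q∣ : ∀ (p q : Subset k) → ∣ p ∣ ≡ ∣ p ─ q ∣ + ∣ p ∩ q ∣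
∣p∣≡∣p─q∣+∣p∩q∣ [] [] = refl
∣p∣≡∣p─q∣+∣p∩q∣ (inside ∷ p) (inside ∷ q) = trans (cong suc (∣p∣≡∣p─q∣+∣p∩q∣ p q)) (sym (+-suc _ _))
∣p∣≡∣p─q∣+∣p∩q∣ (inside ∷ p) (outside ∷ q) = cong suc (∣p∣≡∣p─q∣+∣p∩q∣ p q)
∣p∣≡∣p─q∣+∣p∩q∣ (outside ∷ p) (inside ∷ q) = ∣p∣≡∣p─q∣+∣p∩q∣ p q
∣p∣≡∣p─q∣+∣p∩q∣ (outside ∷ p) (outside ∷ q) = ∣p∣≡∣p─q∣+∣p∩q∣ p q

∣p∪q∣+∣p∩q∣≡∣p∣+∣q∣ : ∀ (p q : Subset k) → ∣ p ∪ q ∣ + ∣ p ∩ q ∣ ≡ ∣ p ∣ + ∣ q ∣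
∣p∪q∣+∣p∩q∣≡∣p∣+∣q∣ [] [] = refl
∣p∪q∣+∣p∩q∣≡∣p∣+∣q∣ (inside ∷ p) (inside ∷ q) =
  cong suc (trans (+-suc _ _) (trans (cong suc (∣p∪q∣+∣p∩q∣≡∣p∣+∣q∣ p q)) (sym (+-suc _ _))))
∣p∪q∣+∣p∩q∣≡∣p∣+∣q∣ (inside ∷ p) (outside ∷ q) = cong suc (∣p∪q∣+∣p∩q∣≡∣p∣+∣q∣ p q)
∣p∪q∣+∣p∩q∣≡∣p∣+∣q∣ (outside ∷ p) (inside ∷ q) =
  trans (cong suc (∣p∪q∣+∣p∩q∣≡∣p∣+∣q∣ p q)) (sym (+-suc _ _))
∣p∪q∣+∣p∩q∣≡∣p∣+∣q∣ (outside ∷ p) (outside ∷ q) = ∣p∪q∣+∣p∩q∣≡∣p∣+∣q∣ p q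

∣p∪q∣≡∣p∣+∣q∣ : Empty (p ∩ q) → ∣ p ∪ q ∣ ≡ ∣ p ∣ + ∣ q ∣
∣p∪q∣≡∣p∣+∣q∣ {k} {p} {q} disjoint = begin
  ∣ p ∪ q ∣                ≡⟨ sym (+-identityʳ _) ⟩
  ∣ p ∪ q ∣ + 0            ≡⟨ cong (∣ p ∪ q ∣ +_) (sym (∣⊥∣≡0 k)) ⟩
  ∣ p ∪ q ∣ + ∣ ⊥ {k} ∣    ≡⟨ cong (λ s → ∣ p ∪ q ∣ + ∣ s ∣) (sym (Empty-unique disjoint)) ⟩
  ∣ p ∪ q ∣ + ∣ p ∩ q ∣    ≡⟨ ∣p∪q∣+∣p∩q∣≡∣p∣+∣q∣ p q ⟩
  ∣ p ∣ + ∣ q ∣            ∎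
  where open ≡-Reasoning

∣p∪⁅x⁆∣≡1+∣p∣ : x ∉ p → ∣ p ∪ ⁅ x ⁆ ∣ ≡ suc ∣ p ∣
∣p∪⁅x⁆∣≡1+∣p∣ {x = x} {p = p} x∉p = begin
  ∣ p ∪ ⁅ x ⁆ ∣     ≡⟨ ∣p∪q∣≡∣p∣+∣q∣ disjoint ⟩
  ∣ p ∣ + ∣ ⁅ x ⁆ ∣ ≡⟨ cong (∣ p ∣ +_) (∣⁅x⁆∣≡1 x) ⟩
  ∣ p ∣ + 1         ≡⟨ +-comm ∣ p ∣ 1 ⟩
  suc ∣ p ∣         ∎
  where
  open ≡-Reasoning
  disjoint : Empty (p ∩ ⁅ x ⁆)
  disjoint (y , y∈) with x∈p∩q⁻ p ⁅ x ⁆ y∈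
  ... | y∈p , y∈⁅x⁆ = x∉p (subst (_∈ p) (x∈⁅y⁆⇒x≡y x y∈⁅x⁆) y∈p)

∣p∣≡∣p─q∣+∣q∣ : q ⊆ p → ∣ p ∣ ≡ ∣ p ─ q ∣ + ∣ q ∣
∣p∣≡∣p─q∣+∣q∣ {q = q} {p = p} q⊆p =
  trans (∣p∣≡∣p─q∣+∣p∩q∣ p q) (cong (λ s → ∣ p ─ q ∣ + ∣ s ∣) p∩q≡q)
  where
  p∩q≡q : p ∩ q ≡ q
  p∩q≡q = ⊆-antisym (p∩q⊆q p q) (λ x∈q → x∈p∩q⁺ (q⊆p x∈q , x∈q))

∣p─q∣≡1+∣p─q∪⁅x⁆∣ : x ∈ p → x ∉ q → ∣ p ─ q ∣ ≡ suc ∣ p ─ (q ∪ ⁅ x ⁆) ∣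
∣p─q∣≡1+∣p─q∪⁅x⁆∣ {x = x} {p = p} {q = q} x∈p x∉q =
  trans (∣p∣≡1+∣p-x∣ (x∈p∧x∉q⇒x∈p─q x∈p x∉q)) (cong (suc ∘ ∣_∣) (p─q─r≡p─q∪r p q ⁅ x ⁆))

∃-subset-of-size : ∀ d (p : Subset k) → d ≤ ∣ p ∣ → ∃ λ q → q ⊆ p × ∣ q ∣ ≡ d
∃-subset-of-size {k} zero p _ = ⊥ , ⊥⊆ , ∣⊥∣≡0 k
∃-subset-of-size (suc d) (inside ∷ p) (s≤s d≤∣p∣) with ∃-subset-of-size d p d≤∣p∣
... | q , q⊆p , ∣q∣≡d = inside ∷ q , in⊆in q⊆p , cong suc ∣q∣≡d
∃-subset-of-size (suc d) (outside ∷ p) d≤∣p∣ with ∃-subset-of-size (suc d) p d≤∣p∣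
... | q , q⊆p , ∣q∣≡d = outside ∷ q , out⊆ q⊆p , ∣q∣≡d

injection⇒∣p∣≤∣q∣ : ∀ {a b} {p : Subset a} {q : Subset b} (f : ∀ x → x ∈ p → Fin b) →
  (∀ {x} (x∈p : x ∈ p) → f x x∈p ∈ q) →
  (∀ {x y} (x∈p : x ∈ p) (y∈p : y ∈ p) → f x x∈p ≡ f y y∈p → x ≡ y) →
  ∣ p ∣ ≤ ∣ q ∣
injection⇒∣p∣≤∣q∣ {p = []} _ _ _ = z≤n
injection⇒∣p∣≤∣q∣ {p = outside ∷ p} f f∈q f-inj =
  injection⇒∣p∣≤∣q∣ (λ x x∈p → f (suc x) (there x∈p)) (f∈q ∘ there)
    (λ x∈p y∈p eq → suc-injective (f-inj (there x∈p) (there y∈p) eq))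
injection⇒∣p∣≤∣q∣ {p = inside ∷ p} {q} f f∈q f-inj = begin
  suc ∣ p ∣               ≤⟨ s≤s (injection⇒∣p∣≤∣q∣ (λ x x∈p → f (suc x) (there x∈p)) f-suc∈
                               (λ x∈p y∈p eq → suc-injective (f-inj (there x∈p) (there y∈p) eq))) ⟩
  suc ∣ q - f zero here ∣ ≡⟨ sym (∣p∣≡1+∣p-x∣ (f∈q here)) ⟩
  ∣ q ∣                   ∎
  where
  open ≤-Reasoning
  f-suc∈ : ∀ {x} (x∈p : x ∈ p) → f (suc x) (there x∈p) ∈ q - f zero here
  f-suc∈ x∈p = x∈p∧x≢y⇒x∈p-y (f∈q (there x∈p)) λ eq → case f-inj (there x∈p) here eq of λ ()

module MatroidBasis {m : ℕ} (M : Matroid m) where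
  open Matroid M

  r⊥≡0 : r ⊥ ≡ 0
  r⊥≡0 = n≤0⇒n≡0 (≤-trans (r-bound ⊥) (≤-reflexive (∣⊥∣≡0 m)))

  r[X∪⁅e⁆]≤1+r[X] : ∀ X e → r (X ∪ ⁅ e ⁆) ≤ suc (r X)
  r[X∪⁅e⁆]≤1+r[X] X e = begin
    r (X ∪ ⁅ e ⁆)                 ≤⟨ m≤m+n _ _ ⟩
    r (X ∪ ⁅ e ⁆) + r (X ∩ ⁅ e ⁆) ≤⟨ r-submod X ⁅ e ⁆ ⟩
    r X + r ⁅ e ⁆                 ≤⟨ +-monoʳ-≤ (r X) (subst (r ⁅ e ⁆ ≤_) (∣⁅x⁆∣≡1 e) (r-bound ⁅ e ⁆)) ⟩
    r X + 1                       ≡⟨ +-comm (r X) 1 ⟩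
    suc (r X)                     ∎
    where open ≤-Reasoning

  r-submod-⊆ : ∀ {A B X Y} → X ⊆ A ∪ B → Y ⊆ A ∩ B → r X + r Y ≤ r A + r B
  r-submod-⊆ {A} {B} X⊆A∪B Y⊆A∩B = ≤-trans (+-mono-≤ (r-mono X⊆A∪B) (r-mono Y⊆A∩B)) (r-submod A B)

  record Basis (X : Subset m) : Set where
    field
      base             : Subset m
      base⊆            : base ⊆ X
      base-independent : r base ≡ ∣ base ∣
      base-spanning    : r base ≡ r X

  basis-∪⁅⁆ : ∀ {X e} → e ∈ X → Basis (X - e) → Basis X
  basis-∪⁅⁆ {X} {e} e∈X b = extend (r (B ∪ ⁅ e ⁆) ≤? r B)
    where
    open Basis b renaming (base to B)
    B⊆X : B ⊆ X
    B⊆X = ⊆-trans base⊆ (p─q⊆p X ⁅ e ⁆)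
    B∪⁅e⁆⊆X : B ∪ ⁅ e ⁆ ⊆ X
    B∪⁅e⁆⊆X = ∪-⊆ B⊆X (∈⇒⁅⁆⊆ e∈X)
    -- Submodularity for B ∪ ⁅ e ⁆ and X - e, whose union is X and whose intersection contains B.
    rX≤r[B∪⁅e⁆] : r X ≤ r (B ∪ ⁅ e ⁆)
    rX≤r[B∪⁅e⁆] = +-cancelʳ-≤ (r B) (r X) (r (B ∪ ⁅ e ⁆)) (begin
      r X + r B                   ≤⟨ r-submod-⊆ X⊆ B⊆ ⟩
      r (B ∪ ⁅ e ⁆) + r (X - e)   ≡⟨ cong (r (B ∪ ⁅ e ⁆) +_) (sym base-spanning) ⟩
      r (B ∪ ⁅ e ⁆) + r B         ∎)
      where
      open ≤-Reasoning
      X⊆ : X ⊆ (B ∪ ⁅ e ⁆) ∪ (X - e)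
      X⊆ {y} y∈X with y ≟ e
      ... | yes refl = p⊆p∪q (X - e) (q⊆p∪q B ⁅ e ⁆ (x∈⁅x⁆ e))
      ... | no y≢e   = q⊆p∪q (B ∪ ⁅ e ⁆) (X - e) (x∈p∧x≢y⇒x∈p-y y∈X y≢e)
      B⊆ : B ⊆ (B ∪ ⁅ e ⁆) ∩ (X - e)
      B⊆ y∈B = x∈p∩q⁺ (p⊆p∪q ⁅ e ⁆ y∈B , base⊆ y∈B)
    extend : Dec (r (B ∪ ⁅ e ⁆) ≤ r B) → Basis X
    extend (yes r[B∪⁅e⁆]≤r[B]) = record
      { base             = B
      ; base⊆            = B⊆X
      ; base-independent = base-independent
      ; base-spanning    = ≤-antisym (r-mono B⊆X) (≤-trans rX≤r[B∪⁅e⁆] r[B∪⁅e⁆]≤r[B])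
      }
    extend (no r[B∪⁅e⁆]≰r[B]) = record
      { base             = B ∪ ⁅ e ⁆
      ; base⊆            = B∪⁅e⁆⊆X
      ; base-independent = begin
          r (B ∪ ⁅ e ⁆) ≡⟨ ≤-antisym (r[X∪⁅e⁆]≤1+r[X] B e) (≰⇒> r[B∪⁅e⁆]≰r[B]) ⟩
          suc (r B)     ≡⟨ cong suc base-independent ⟩
          suc ∣ B ∣      ≡⟨ sym (∣p∪⁅x⁆∣≡1+∣p∣ (λ e∈B → x∈p─q⇒x∉q (base⊆ e∈B) (x∈⁅x⁆ e))) ⟩
          ∣ B ∪ ⁅ e ⁆ ∣  ∎
      ; base-spanning    = ≤-antisym (r-mono B∪⁅e⁆⊆X) rX≤r[B∪⁅e⁆]
      }
      where open ≡-Reasoning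

  basis : ∀ X → Basis X
  basis X = go X (⊂-wellFounded X)
    where
    go : ∀ X → Acc _⊂_ X → Basis X
    go X _ with nonempty? X
    ... | no X-empty = record
      { base             = ⊥
      ; base⊆            = ⊥⊆
      ; base-independent = trans r⊥≡0 (sym (∣⊥∣≡0 m))
      ; base-spanning    = cong r (sym (Empty-unique X-empty))
      }
    go X (acc smaller) | yes (e , e∈X) = basis-∪⁅⁆ e∈X (go (X - e) (smaller (x∈p⇒p-x⊂p e∈X)))

module Incidence {n m : ℕ} (ends : Fin m → Fin n × Fin n) where

  EndsIn : Fin m → Subset n → Set
  EndsIn e P = proj₁ (ends e) ∈ P × proj₂ (ends e) ∈ P

  private
    variable
      e e₁ e₂ : Fin m
      v y z : Fin n
      K P : Subset n
      F : Subset m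
      G H : Graph n m

  joins-sym : Joins ends e y z → Joins ends e z y
  joins-sym (inj₁ e≡yz) = inj₂ e≡yz
  joins-sym (inj₂ e≡zy) = inj₁ e≡zy

  joins⇒incident : Joins ends e v y → Incident ends e v
  joins⇒incident (inj₁ e≡vy) = inj₁ (cong proj₁ e≡vy)
  joins⇒incident (inj₂ e≡yv) = inj₂ (cong proj₂ e≡yv)

  joins-functional : Joins ends e v y → Joins ends e v z → y ≡ z
  joins-functional (inj₁ p) (inj₁ q) = ,-injectiveʳ (trans (sym p) q)
  joins-functional (inj₁ p) (inj₂ q) = let v≡z , y≡v = ,-injective (trans (sym p) q) in trans y≡v v≡z
  joins-functional (inj₂ p) (inj₁ q) = let y≡v , v≡z = ,-injective (trans (sym p) q) in trans y≡v v≡z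
  joins-functional (inj₂ p) (inj₂ q) = ,-injectiveˡ (trans (sym p) q)

  joins⇒endsIn : Joins ends e y z → y ∈ P → z ∈ P → EndsIn e P
  joins⇒endsIn (inj₁ refl) y∈P z∈P = y∈P , z∈P
  joins⇒endsIn (inj₂ refl) y∈P z∈P = z∈P , y∈P

  endsIn⇒∈ : Joins ends e y z → EndsIn e P → z ∈ P
  endsIn⇒∈ (inj₁ refl) (_ , z∈P) = z∈P
  endsIn⇒∈ (inj₂ refl) (z∈P , _) = z∈P

  semisimple-joins : Semisimple ends → Joins ends e₁ y z → Joins ends e₂ y z → e₁ ≡ e₂
  semisimple-joins {e₁} {e₂ = e₂} ss (inj₁ e₁≡yz) j₂ =
    ss e₁ e₂ (subst (λ ab → Joins ends e₂ (proj₁ ab) (proj₂ ab)) (sym e₁≡yz) j₂)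
  semisimple-joins {e₁} {e₂ = e₂} ss (inj₂ e₁≡zy) j₂ =
    ss e₁ e₂ (subst (λ ab → Joins ends e₂ (proj₁ ab) (proj₂ ab)) (sym e₁≡zy) (joins-sym j₂))

  private
    otherEnd : Fin n → Fin n × Fin n → Fin n
    otherEnd v (a , b) with a ≟ v
    ... | yes _ = b
    ... | no  _ = a

    otherEnd-pair : ∀ v ab → (proj₁ ab ≡ v) ⊎ (proj₂ ab ≡ v) →
      (ab ≡ (v , otherEnd v ab)) ⊎ (ab ≡ (otherEnd v ab , v))
    otherEnd-pair v (a , b) incident with a ≟ v | incident
    ... | yes refl | _         = inj₁ refl
    ... | no a≢v   | inj₁ a≡v  = ⊥-elim (a≢v a≡v)
    ... | no _     | inj₂ refl = inj₂ refl

  -- For a loop at v the other end is v itself.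
  other : Fin n → Fin m → Fin n
  other v e = otherEnd v (ends e)

  incident⇒joins-other : Incident ends e v → Joins ends e v (other v e)
  incident⇒joins-other {e} {v} = otherEnd-pair v (ends e)

  incidentEdges : Fin n → Subset m
  incidentEdges v = tabulate λ e → does ((proj₁ (ends e) ≟ v) ⊎-dec (proj₂ (ends e) ≟ v))

  ∈-incidentEdges⁻ : e ∈ incidentEdges v → Incident ends e v
  ∈-incidentEdges⁻ {v = v} = ∈-tabulate⁻ λ e → (proj₁ (ends e) ≟ v) ⊎-dec (proj₂ (ends e) ≟ v)

  ∈-incidentEdges⁺ : Incident ends e v → e ∈ incidentEdges v
  ∈-incidentEdges⁺ {v = v} = ∈-tabulate⁺ λ e → (proj₁ (ends e) ≟ v) ⊎-dec (proj₂ (ends e) ≟ v)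

  N⁻ : y ∈ N ends G v → ∃ λ e → e ∈ E G × Joins ends e v y
  N⁻ {G = G} {v} = ∈-tabulate⁻ λ y → any? λ e → (e ∈? E G) ×-dec joins? ends e v y

  N⁺ : e ∈ E G → Joins ends e v y → y ∈ N ends G v
  N⁺ {e} {G} {v} e∈G j = ∈-tabulate⁺ (λ y → any? λ e → (e ∈? E G) ×-dec joins? ends e v y) (e , e∈G , j)

  N-mono : E H ⊆ E G → N ends H v ⊆ N ends G v
  N-mono {H = H} {G} H⊆G y∈N with N⁻ {G = H} y∈N
  ... | e , e∈H , j = N⁺ {G = G} (H⊆G e∈H) j

  induced⁻ : e ∈ E (induced ends G K) → e ∈ E G × EndsIn e K
  induced⁻ {G = G} {K} =
    ∈-tabulate⁻ λ e → (e ∈? E G) ×-dec ((proj₁ (ends e) ∈? K) ×-dec (proj₂ (ends e) ∈? K))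

  induced⁺ : e ∈ E G → EndsIn e K → e ∈ E (induced ends G K)
  induced⁺ {G = G} {K} e∈G endsIn =
    ∈-tabulate⁺ (λ e → (e ∈? E G) ×-dec ((proj₁ (ends e) ∈? K) ×-dec (proj₂ (ends e) ∈? K)))
      (e∈G , endsIn)

  induced-WF : F ⊆ E (induced ends G K) → WF ends (graph K F)
  induced-WF {G = G} F⊆ _ e∈F = proj₂ (induced⁻ {G = G} (F⊆ e∈F))

  induced-⊆ : F ⊆ E (induced ends G K) → F ⊆ E G
  induced-⊆ {G = G} F⊆ e∈F = proj₁ (induced⁻ {G = G} (F⊆ e∈F))

  ⊆-induced : WF ends (graph K F) → F ⊆ E G → F ⊆ E (induced ends G K)
  ⊆-induced {G = G} wf F⊆G {e} e∈F = induced⁺ {G = G} (F⊆G e∈F) (wf e e∈F)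

module ZeroExtensions {n m : ℕ} (ends : Fin m → Fin n × Fin n) where
  open Incidence ends

  private
    variable
      d : ℕ
      v : Fin n
      H H₁ H₂ B : Graph n m

  zeroExts-WF : WF ends H → ZeroExts ends d H B → WF ends B
  zeroExts-WF wf ε = wf
  zeroExts-WF _ ((_ , wf₂ , _) ◅ chain) = zeroExts-WF wf₂ chain

  zeroExts-V⊆ : ZeroExts ends d H B → V H ⊆ V B
  zeroExts-V⊆ ε = λ x∈ → x∈
  zeroExts-V⊆ ((_ , _ , v , _ , V₂≡ , _) ◅ chain) x∈ =
    zeroExts-V⊆ chain (subst (_ ∈_) (sym V₂≡) (p⊆p∪q ⁅ v ⁆ x∈))

  zeroExts-E⊆ : ZeroExts ends d H B → E H ⊆ E B
  zeroExts-E⊆ ε = λ e∈ → e∈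
  zeroExts-E⊆ ((_ , _ , _ , _ , _ , E⊆E₂ , _) ◅ chain) = zeroExts-E⊆ chain ∘ E⊆E₂

  ∣E∣-zeroExts : ZeroExts ends d H B → ∣ E B ∣ ≡ ∣ E H ∣ + d * ∣ V B ─ V H ∣
  ∣E∣-zeroExts {d} {H} ε = begin
    ∣ E H ∣                     ≡⟨ sym (+-identityʳ _) ⟩
    ∣ E H ∣ + 0                 ≡⟨ cong (∣ E H ∣ +_) (sym (*-zeroʳ d)) ⟩
    ∣ E H ∣ + d * 0             ≡⟨ cong (λ k → ∣ E H ∣ + d * k) (sym (∣p─p∣≡0 (V H))) ⟩
    ∣ E H ∣ + d * ∣ V H ─ V H ∣  ∎
    where open ≡-Reasoning
  ∣E∣-zeroExts {d} {H} {B} (_◅_ {j = H₂} (_ , _ , v , v∉H , V₂≡ , _ , _ , ∣E₂∣) chain) = begin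
    ∣ E B ∣                                    ≡⟨ ∣E∣-zeroExts chain ⟩
    ∣ E H₂ ∣ + d * ∣ V B ─ V H₂ ∣               ≡⟨ cong (_+ d * ∣ V B ─ V H₂ ∣) ∣E₂∣ ⟩
    ∣ E H ∣ + d + d * ∣ V B ─ V H₂ ∣            ≡⟨ m+n+n*o≡m+n*[1+o] ∣ E H ∣ d _ ⟩
    ∣ E H ∣ + d * suc ∣ V B ─ V H₂ ∣            ≡⟨ cong (λ X → ∣ E H ∣ + d * suc ∣ V B ─ X ∣) V₂≡ ⟩
    ∣ E H ∣ + d * suc ∣ V B ─ (V H ∪ ⁅ v ⁆) ∣   ≡⟨ cong (λ k → ∣ E H ∣ + d * k)
                                                     (sym (∣p─q∣≡1+∣p─q∪⁅x⁆∣ v∈B v∉H)) ⟩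
    ∣ E H ∣ + d * ∣ V B ─ V H ∣                 ∎
    where
    open ≡-Reasoning
    v∈B : v ∈ V B
    v∈B = zeroExts-V⊆ chain (subst (v ∈_) (sym V₂≡) (q⊆p∪q (V H) ⁅ v ⁆ (x∈⁅x⁆ v)))

  zeroExts-independent : (M : Matroid m) → ZeroExtProperty ends M d →
    Independent ends M H → ZeroExts ends d H B → Independent ends M B
  zeroExts-independent M zep independent ε = independent
  zeroExts-independent M zep independent (ext@(wf₁ , wf₂ , _) ◅ chain) =
    zeroExts-independent M zep (zep _ _ wf₁ wf₂ independent ext) chain

  new-edges-degree : Semisimple ends → WF ends H₂ → E H₁ ⊆ E H₂ →
    (∀ e → e ∈ E H₂ → e ∉ E H₁ → Incident ends e v) → ∣ E H₂ ∣ ≡ ∣ E H₁ ∣ + d →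
    d ≤ ∣ V H₂ ∩ N ends H₂ v ∣
  new-edges-degree {H₂} {H₁} {v} {d} ss wf₂ E₁⊆E₂ new-incident ∣E₂∣ =
    subst (_≤ ∣ V H₂ ∩ N ends H₂ v ∣) ∣new∣≡d
      (injection⇒∣p∣≤∣q∣ (λ e _ → other v e) other∈ other-injective)
    where
    new = E H₂ ─ E H₁
    joins-other : ∀ {e} → e ∈ new → Joins ends e v (other v e)
    joins-other e∈new =
      incident⇒joins-other (new-incident _ (p─q⊆p (E H₂) (E H₁) e∈new) (x∈p─q⇒x∉q e∈new))
    other∈ : ∀ {e} → e ∈ new → other v e ∈ V H₂ ∩ N ends H₂ v
    other∈ {e} e∈new = x∈p∩q⁺
      ( endsIn⇒∈ (joins-other e∈new) (wf₂ e (p─q⊆p (E H₂) (E H₁) e∈new))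
      , N⁺ {G = H₂} (p─q⊆p (E H₂) (E H₁) e∈new) (joins-other e∈new))
    other-injective : ∀ {e₁ e₂} (e₁∈ : e₁ ∈ new) (e₂∈ : e₂ ∈ new) →
      other v e₁ ≡ other v e₂ → e₁ ≡ e₂
    other-injective e₁∈ e₂∈ eq =
      semisimple-joins ss (joins-other e₁∈) (subst (Joins ends _ v) (sym eq) (joins-other e₂∈))
    ∣new∣≡d : ∣ new ∣ ≡ d
    ∣new∣≡d = +-cancelʳ-≡ ∣ E H₁ ∣ ∣ new ∣ d
      (trans (sym (∣p∣≡∣p─q∣+∣q∣ E₁⊆E₂)) (trans ∣E₂∣ (+-comm ∣ E H₁ ∣ d)))

module Growth {n m : ℕ} (ends : Fin m → Fin n × Fin n) (G : Graph n m) (d : ℕ) where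
  open Incidence ends
  open ZeroExtensions ends

  private
    variable
      v : Fin n
      K K' : Subset n
      F : Subset m
      H B : Graph n m

  -- Condition (ii) of an M-seed: Seed ends M d G K unfolds to (condition (i)) × Growable K.
  Growable : Subset n → Set
  Growable K = ∀ K' → K ⊆ K' → K' ⊆ V G → K' ≢ V G →
    Σ (Fin n) λ x → (x ∈ V G) × (x ∉ K') × (d ≤ ∣ (K' ∪ ⁅ x ⁆) ∩ N ends G x ∣)

  growable-⊆ : K ⊆ K' → Growable K → Growable K'
  growable-⊆ K⊆K' grow K'' K'⊆K'' = grow K'' (⊆-trans K⊆K' K'⊆K'')

  zeroExt-within : WF ends (graph K F) → F ⊆ E G → v ∉ K → d ≤ ∣ (K ∪ ⁅ v ⁆) ∩ N ends G v ∣ →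
    ∃ λ F' → ZeroExt ends d (graph K F) (graph (K ∪ ⁅ v ⁆) F') × F' ⊆ E G
  zeroExt-within {K} {F} {v} wf F⊆G v∉K d≤deg = extend (∃-subset-of-size d A d≤∣A∣)
    where
    K+v = K ∪ ⁅ v ⁆
    v∈K+v : v ∈ K+v
    v∈K+v = q⊆p∪q K ⁅ v ⁆ (x∈⁅x⁆ v)

    -- Distinct neighbours of v in K + v are reached by distinct edges of G[K + v] at v,
    -- so d of these edges can be chosen as the new ones.
    A : Subset m
    A = E (induced ends G K+v) ∩ incidentEdges v
    A⁻ : ∀ {e} → e ∈ A → e ∈ E G × EndsIn e K+v × Incident ends e v
    A⁻ e∈A with x∈p∩q⁻ (E (induced ends G K+v)) (incidentEdges v) e∈A
    ... | e∈G[K+x] , e∈inc with induced⁻ {G = G} e∈G[K+x]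
    ...   | e∈G , endsIn = e∈G , endsIn , ∈-incidentEdges⁻ e∈inc

    edge : ∀ y → y ∈ K+v ∩ N ends G v → Fin m
    edge y y∈ = proj₁ (N⁻ {G = G} (proj₂ (x∈p∩q⁻ K+v (N ends G v) y∈)))
    edge-joins : ∀ {y} (y∈ : y ∈ K+v ∩ N ends G v) → Joins ends (edge y y∈) v y
    edge-joins y∈ = proj₂ (proj₂ (N⁻ {G = G} (proj₂ (x∈p∩q⁻ K+v (N ends G v) y∈))))
    edge∈A : ∀ {y} (y∈ : y ∈ K+v ∩ N ends G v) → edge y y∈ ∈ A
    edge∈A y∈ = x∈p∩q⁺
      ( induced⁺ {G = G} (proj₁ (proj₂ (N⁻ {G = G} (proj₂ (x∈p∩q⁻ K+v (N ends G v) y∈)))))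
          (joins⇒endsIn (edge-joins y∈) v∈K+v (proj₁ (x∈p∩q⁻ K+v (N ends G v) y∈)))
      , ∈-incidentEdges⁺ (joins⇒incident (edge-joins y∈)))
    edge-injective : ∀ {y z} (y∈ : y ∈ K+v ∩ N ends G v) (z∈ : z ∈ K+v ∩ N ends G v) →
      edge y y∈ ≡ edge z z∈ → y ≡ z
    edge-injective y∈ z∈ eq =
      joins-functional (edge-joins y∈) (subst (λ e → Joins ends e v _) (sym eq) (edge-joins z∈))
    d≤∣A∣ : d ≤ ∣ A ∣
    d≤∣A∣ = ≤-trans d≤deg (injection⇒∣p∣≤∣q∣ edge edge∈A edge-injective)

    extend : (∃ λ S → S ⊆ A × ∣ S ∣ ≡ d) →
      ∃ λ F' → ZeroExt ends d (graph K F) (graph K+v F') × F' ⊆ E G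
    extend (S , S⊆A , ∣S∣≡d) =
      F ∪ S , (wf , wf' , v , v∉K , refl , p⊆p∪q S , new-incident , ∣F∪S∣) , ∪-⊆ F⊆G (proj₁ ∘ A⁻ ∘ S⊆A)
      where
      wf' : WF ends (graph K+v (F ∪ S))
      wf' e e∈ with x∈p∪q⁻ F S e∈
      ... | inj₁ e∈F = p⊆p∪q ⁅ v ⁆ (proj₁ (wf e e∈F)) , p⊆p∪q ⁅ v ⁆ (proj₂ (wf e e∈F))
      ... | inj₂ e∈S = proj₁ (proj₂ (A⁻ (S⊆A e∈S)))
      new-incident : ∀ e → e ∈ F ∪ S → e ∉ F → Incident ends e v
      new-incident e e∈ e∉F with x∈p∪q⁻ F S e∈
      ... | inj₁ e∈F = ⊥-elim (e∉F e∈F)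
      ... | inj₂ e∈S = proj₂ (proj₂ (A⁻ (S⊆A e∈S)))
      disjoint : Empty (F ∩ S)
      disjoint (e , e∈) with x∈p∩q⁻ F S e∈
      ... | e∈F , e∈S =
        v∉K (endsIn⇒∈ (joins-sym (incident⇒joins-other (proj₂ (proj₂ (A⁻ (S⊆A e∈S)))))) (wf e e∈F))
      ∣F∪S∣ : ∣ F ∪ S ∣ ≡ ∣ F ∣ + d
      ∣F∪S∣ = trans (∣p∪q∣≡∣p∣+∣q∣ disjoint) (cong (∣ F ∣ +_) ∣S∣≡d)

  spanning-zeroExts : Growable K → K ⊆ V G → WF ends (graph K F) → F ⊆ E G →
    ∃ λ B → ZeroExts ends d (graph K F) B × V B ≡ V G × E B ⊆ E G
  spanning-zeroExts {K} = go (⊃-wellFounded K)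
    where
    go : ∀ {K F} → Acc _⊃_ K → Growable K → K ⊆ V G → WF ends (graph K F) → F ⊆ E G →
      ∃ λ B → ZeroExts ends d (graph K F) B × V B ≡ V G × E B ⊆ E G
    go {K} {F} (acc larger) grow K⊆V wf F⊆G with ≡-dec _≟ᵇ_ K (V G)
    ... | yes K≡V = graph K F , ε , K≡V , F⊆G
    ... | no K≢V with grow K ⊆-refl K⊆V K≢V
    ... | x , x∈V , x∉K , d≤deg with zeroExt-within wf F⊆G x∉K d≤deg
    ... | F' , ext , F'⊆G with go (larger (p⊆p∪q ⁅ x ⁆ , x , q⊆p∪q K ⁅ x ⁆ (x∈⁅x⁆ x) , x∉K))
                                  (growable-⊆ (p⊆p∪q ⁅ x ⁆) grow) (∪-⊆ K⊆V (∈⇒⁅⁆⊆ x∈V))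
                                  (proj₁ (proj₂ ext)) F'⊆G
    ... | B , chain , V≡ , E⊆ = B , ext ◅ chain , V≡ , E⊆

  zeroExts⇒growable : Semisimple ends → ZeroExts ends d H B → V B ≡ V G → E B ⊆ E G →
    Growable (V H)
  zeroExts⇒growable ss ε V≡ _ K' H⊆K' K'⊆V K'≢V =
    ⊥-elim (K'≢V (⊆-antisym K'⊆V (λ x∈V → H⊆K' (subst (_ ∈_) (sym V≡) x∈V))))
  zeroExts⇒growable {H} ss (_◅_ {j = H₂} (_ , wf₂ , v , _ , V₂≡ , E⊆E₂ , new-incident , ∣E₂∣) chain)
                    V≡ E⊆G K' H⊆K' K'⊆V K'≢V with v ∈? K'
  ... | yes v∈K' = zeroExts⇒growable ss chain V≡ E⊆G K' H₂⊆K' K'⊆V K'≢V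
    where
    H₂⊆K' : V H₂ ⊆ K'
    H₂⊆K' = subst (_⊆ K') (sym V₂≡) (∪-⊆ H⊆K' (∈⇒⁅⁆⊆ v∈K'))
  ... | no v∉K' = v , v∈V , v∉K' ,
    ≤-trans (new-edges-degree {H₁ = H} ss wf₂ E⊆E₂ new-incident ∣E₂∣)
            (p⊆q⇒∣p∣≤∣q∣ (∩-mono H₂⊆K'+v (N-mono {H = H₂} {G = G} (E⊆G ∘ zeroExts-E⊆ chain))))
    where
    v∈V : v ∈ V G
    v∈V = subst (v ∈_) V≡ (zeroExts-V⊆ chain (subst (v ∈_) (sym V₂≡) (q⊆p∪q (V H) ⁅ v ⁆ (x∈⁅x⁆ v))))
    H₂⊆K'+v : V H₂ ⊆ K' ∪ ⁅ v ⁆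
    H₂⊆K'+v = subst (_⊆ K' ∪ ⁅ v ⁆) (sym V₂≡) (∪-⊆ (⊆-trans H⊆K' (p⊆p∪q ⁅ v ⁆)) (q⊆p∪q K' ⁅ v ⁆))

module Seeds {n m : ℕ} (ends : Fin m → Fin n × Fin n) (M : Matroid m) (G : Graph n m) (d : ℕ)
             (zep : ZeroExtProperty ends M d) where
  open Matroid M
  open MatroidBasis M
  open Incidence ends
  open ZeroExtensions ends
  open Growth ends G d

  private
    variable
      v : Fin n
      K : Subset n
      H H' : Graph n m

  r-zeroExts : Independent ends M H → ZeroExts ends d H H' → r (E H') ≡ ∣ E H ∣ + d * ∣ V H' ─ V H ∣
  r-zeroExts independent chain = trans (zeroExts-independent M zep independent chain) (∣E∣-zeroExts chain)

  r-induced-∪⁅⁆ : v ∉ K → d ≤ ∣ (K ∪ ⁅ v ⁆) ∩ N ends G v ∣ →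
    r (E (induced ends G K)) + d ≤ r (E (induced ends G (K ∪ ⁅ v ⁆)))
  r-induced-∪⁅⁆ {v} {K} v∉K d≤deg =
    extend (zeroExt-within (induced-WF {G = G} base⊆) (induced-⊆ {G = G} base⊆) v∉K d≤deg)
    where
    open Basis (basis (E (induced ends G K)))
    extend : (∃ λ F' → ZeroExt ends d (graph K base) (graph (K ∪ ⁅ v ⁆) F') × F' ⊆ E G) →
      r (E (induced ends G K)) + d ≤ r (E (induced ends G (K ∪ ⁅ v ⁆)))
    extend (F' , ext@(wf , wf' , _ , _ , _ , _ , _ , ∣F'∣) , F'⊆G) = begin
      r (E (induced ends G K)) + d          ≡⟨ cong (_+ d) (trans (sym base-spanning) base-independent) ⟩
      ∣ base ∣ + d                          ≡⟨ sym ∣F'∣ ⟩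
      ∣ F' ∣                                ≡⟨ sym (zep _ _ wf wf' base-independent ext) ⟩
      r F'                                  ≤⟨ r-mono (⊆-induced {G = G} wf' F'⊆G) ⟩
      r (E (induced ends G (K ∪ ⁅ v ⁆)))    ∎
      where open ≤-Reasoning

  record SpanningExtension (K : Subset n) : Set where
    field
      F             : Subset m
      F⊆            : F ⊆ E (induced ends G K)
      F-independent : Independent ends M (graph K F)
      B             : Graph n m
      chain         : ZeroExts ends d (graph K F) B
      V-B           : V B ≡ V G
      E-B⊆          : E B ⊆ E G
      r-B           : r (E B) ≡ r (E (induced ends G K)) + d * ∣ V G ─ K ∣

  spanningExtension : Growable K → K ⊆ V G → SpanningExtension K
  spanningExtension {K} grow K⊆V =
    extend (spanning-zeroExts grow K⊆V (induced-WF {G = G} base⊆) (induced-⊆ {G = G} base⊆))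
    where
    open Basis (basis (E (induced ends G K)))
    extend : (∃ λ B → ZeroExts ends d (graph K base) B × V B ≡ V G × E B ⊆ E G) → SpanningExtension K
    extend (B , chain , V≡ , E⊆) = record
      { F = base ; F⊆ = base⊆ ; F-independent = base-independent
      ; B = B ; chain = chain ; V-B = V≡ ; E-B⊆ = E⊆
      ; r-B = begin
          r (E B)                                   ≡⟨ r-zeroExts base-independent chain ⟩
          ∣ base ∣ + d * ∣ V B ─ K ∣                 ≡⟨ cong₂ (λ a X → a + d * ∣ X ─ K ∣)
                                                        (trans (sym base-independent) base-spanning) V≡ ⟩
          r (E (induced ends G K)) + d * ∣ V G ─ K ∣ ∎
      }
      where open ≡-Reasoning

  r-induced-lower-bound : Growable K → K ⊆ V G → r (E (induced ends G K)) + d * ∣ V G ─ K ∣ ≤ r (E G)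
  r-induced-lower-bound grow K⊆V = subst (_≤ r (E G)) r-B (r-mono E-B⊆)
    where open SpanningExtension (spanningExtension grow K⊆V)

  ExtendsToBasis : Subset n → Set
  ExtendsToBasis K = Σ (Subset m) λ F → Σ (Graph n m) λ B →
    _≼_ ends (graph K F) (induced ends G K) ×
    Independent ends M (graph K F) ×
    IsBasis ends M B G ×
    V B ≡ V G ×
    ZeroExts ends d (graph K F) B

  seed⇒extendsToBasis : K ⊆ V G → Seed ends M d G K → ExtendsToBasis K
  seed⇒extendsToBasis K⊆V (r-split , grow) =
    F , B , (induced-WF {G = G} F⊆ , ⊆-refl , F⊆) , F-independent ,
    ((zeroExts-WF (induced-WF {G = G} F⊆) chain , (λ x∈B → subst (_ ∈_) V-B x∈B) , E-B⊆) ,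
     zeroExts-independent M zep F-independent chain , trans r-B (sym r-split)) ,
    V-B , chain
    where open SpanningExtension (spanningExtension grow K⊆V)

  extendsToBasis⇒seed : Semisimple ends → K ⊆ V G → ExtendsToBasis K → Seed ends M d G K
  extendsToBasis⇒seed {K} ss K⊆V
    (F , B , (_ , _ , F⊆) , F-independent , ((_ , _ , B⊆G) , _ , rB≡rG) , V≡ , chain) =
    ≤-antisym upper (r-induced-lower-bound grow K⊆V) , grow
    where
    grow : Growable K
    grow = zeroExts⇒growable ss chain V≡ B⊆G
    upper : r (E G) ≤ r (E (induced ends G K)) + d * ∣ V G ─ K ∣
    upper = begin
      r (E G)                                   ≡⟨ sym rB≡rG ⟩
      r (E B)                                   ≡⟨ r-zeroExts F-independent chain ⟩
      ∣ F ∣ + d * ∣ V B ─ K ∣                    ≡⟨ cong₂ (λ a X → a + d * ∣ X ─ K ∣) (sym F-independent) V≡ ⟩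
      r F + d * ∣ V G ─ K ∣                      ≤⟨ +-monoˡ-≤ (d * ∣ V G ─ K ∣) (r-mono F⊆) ⟩
      r (E (induced ends G K)) + d * ∣ V G ─ K ∣ ∎
      where open ≤-Reasoning

  seed-∪⁅⁆ : K ⊆ V G → Seed ends M d G K → v ∈ V G → v ∉ K →
    d ≤ ∣ (K ∪ ⁅ v ⁆) ∩ N ends G v ∣ → Seed ends M d G (K ∪ ⁅ v ⁆)
  seed-∪⁅⁆ {K} {v} K⊆V (r-split , grow) v∈V v∉K d≤deg =
    ≤-antisym upper (r-induced-lower-bound grow' (∪-⊆ K⊆V (∈⇒⁅⁆⊆ v∈V))) , grow'
    where
    grow' : Growable (K ∪ ⁅ v ⁆)
    grow' = growable-⊆ (p⊆p∪q ⁅ v ⁆) grow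
    rK = r (E (induced ends G K))
    rest = ∣ V G ─ (K ∪ ⁅ v ⁆) ∣
    upper : r (E G) ≤ r (E (induced ends G (K ∪ ⁅ v ⁆))) + d * rest
    upper = begin
      r (E G)                                     ≡⟨ r-split ⟩
      rK + d * ∣ V G ─ K ∣                         ≡⟨ cong (λ k → rK + d * k) (∣p─q∣≡1+∣p─q∪⁅x⁆∣ v∈V v∉K) ⟩
      rK + d * suc rest                           ≡⟨ sym (m+n+n*o≡m+n*[1+o] rK d rest) ⟩
      rK + d + d * rest                           ≤⟨ +-monoˡ-≤ (d * rest) (r-induced-∪⁅⁆ v∉K d≤deg) ⟩
      r (E (induced ends G (K ∪ ⁅ v ⁆))) + d * rest ∎
      where open ≤-Reasoning

lemma3p1 : ∀ {n m} (ends : Fin m → Fin n × Fin n) → Semisimple ends →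
    (M : Matroid m) (G : Graph n m) → WF ends G → (d : ℕ) → 1 ≤ d →
    ZeroExtProperty ends M d →
    (∀ K → K ⊆ V G →
      Seed ends M d G K ⇔
        Σ (Subset m) λ F → Σ (Graph n m) λ B →
          _≼_ ends (graph K F) (induced ends G K) ×
          Independent ends M (graph K F) ×
          IsBasis ends M B G ×
          V B ≡ V G ×
          ZeroExts ends d (graph K F) B)
    ×
    (∀ K v → K ⊆ V G → Seed ends M d G K → v ∈ V G → v ∉ K →
      d ≤ ∣ (K ∪ ⁅ v ⁆) ∩ N ends G v ∣ →
      Seed ends M d G (K ∪ ⁅ v ⁆))
lemma3p1 ends ss M G _ d _ zep =
  (λ K K⊆V → mk⇔ (seed⇒extendsToBasis K⊆V) (extendsToBasis⇒seed ss K⊆V)) ,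
  (λ K v K⊆V → seed-∪⁅⁆ K⊆V)
  where open Seeds ends M G d zep
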